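{- Let $a$ and $m$ be relatively prime positive integers with $m>1$, and let $n=am+1$. Suppose that $n$ has the property that if $m\mid\varphi(n)$ then $n$ is prime. If for each prime $q$ dividing $m$ there exists an integer $b_q$ such that $b_q^{\,n-1}\equiv 1\pmod n$ and $b_q^{\,(n-1)/q}\not\equiv 1\pmod n$, then $n$ is prime.
   Context: $\varphi$ denotes Euler's totient function. -}

module Defs where

open import Data.Nat using (ℕ; suc; _≟_)
open import Data.Nat.GCD using (gcd)
open import Data.List using (List; length; filter; upTo; map)
open import Data.Integer using (ℤ; +_; _-_; _^_)
open import Data.Integer.Divisibility using () renaming (_∣_ to _∣ℤ_)

φ : ℕ → ℕ
φ n = length (filter (λ k → gcd k n ≟ 1) (map suc (upTo n)))

infix 4 _≡_[mod_]
_≡_[mod_] : ℤ → ℤ → ℕ → Set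
x ≡ y [mod n ] = (+ n) ∣ℤ (x - y)

{-# OPTIONS --safe #-}
module Submission where

-- Each b_q has b_q^(n-1) ≡ 1, so it is a unit mod n, and Euler's theorem gives b_q^φ(n) ≡ 1;
-- hence b_q^d ≡ 1 for d = gcd(φ(n), n-1). Write n - 1 = k d. A prime q dividing both m and k
-- would make (n-1)/q a multiple of d, contradicting b_q^((n-1)/q) ≢ 1. So m is coprime to k,
-- and m ∣ k d gives m ∣ d ∣ φ(n), whence n is prime by hypothesis. Euler's theorem itself is
-- the classical argument: multiplication by a unit permutes the reduced residues, so their
-- product P satisfies b^φ(n) P ≡ P, and P is a unit.

open import Defs
open import Data.Nat
  using (ℕ; zero; suc; 2+; pred; _+_; _*_; _/_; _%_; _<_; _>_; s≤s; NonZero; NonTrivial; _≟_; nonTrivial⇒nonZero; nonTrivial⇒n>1)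
  renaming (_^_ to _^ℕ_)
open import Data.Nat.Properties
  using (suc-injective; suc-pred; <-irrefl; <-trans; n<1+n; m≤n⇒m<n∨m≡n; *-comm; *-assoc; *-identityˡ; *-identityʳ
        ; [m*n]*[o*p]≡[m*o]*[n*p]; ^-zeroˡ; ^-*-assoc; ^-distribˡ-+-*)
open import Data.Nat.DivMod using (%-distribˡ-*; m%n%n≡m%n; [m+kn]%n≡m%n; m<n⇒m%n≡m; m%n<n; m≡m%n+[m/n]*n; %-remove-+ʳ)
open import Data.Nat.Divisibility
  using (_∣_; divides; ∣-refl; ∣-trans; _∣0; ∣1⇒≡1; n∣m*n; ∣m⇒∣m*n; *-monoˡ-∣; m*n∣o⇒n∣o/m
        ; %-presˡ-∣; ∣n∣m%n⇒∣m; quotient; m∣n⇒n≡quotient*m)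
open import Data.Nat.GCD using (gcd; gcd-GCD; gcd[m,n]∣m; gcd[m,n]∣n; module Bézout)
open import Data.Nat.Coprimality using (Coprime; coprime⇒gcd≡1; gcd≡1⇒coprime; coprime-Bézout; coprime-divisor; ¬0-coprimeTo-2+)
open import Data.Nat.Primality using (Prime; prime[2]; prime⇒nonZero)
open import Data.Nat.Primality.Factorisation using (factorise)
open import Data.Nat.ListAction using (product)
open import Data.Nat.ListAction.Properties using (product-↭)
open import Data.Integer using (ℤ; +_; _^_; 1ℤ)
import Data.Integer as ℤ
import Data.Integer.Properties as ℤₚ
open import Data.Integer.DivMod using (_%ℕ_; _/ℕ_; a≡a%ℕn+[a/ℕn]*n)
import Data.Integer.Divisibility.Signed as ℤ∣
import Data.Integer.Tactic.RingSolver as ℤ-Solver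
import Data.Nat.Tactic.RingSolver as ℕ-Solver
open import Data.List using (List; []; _∷_; map; filter; upTo; length)
open import Data.List.Properties using (map-∘; map-id-local)
open import Data.List.Membership.Propositional using (_∈_)
open import Data.List.Membership.Propositional.Properties using (∈-map⁺; ∈-map⁻; ∈-filter⁺; ∈-filter⁻; ∈-upTo⁺; ∈-upTo⁻)
open import Data.List.Membership.Propositional.Properties.WithK using (unique∧set⇒bag)
open import Data.List.Relation.Unary.All as All using (All; []; _∷_)
open import Data.List.Relation.Unary.Unique.Propositional using (Unique)
import Data.List.Relation.Unary.Unique.Propositional.Properties as Unique
open import Data.List.Relation.Binary.Permutation.Propositional using (_↭_)
open import Data.List.Relation.Binary.BagAndSetEquality using (∼bag⇒↭)
open import Data.Empty using (⊥; ⊥-elim)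
open import Data.Product using (Σ; _×_; _,_; proj₁; proj₂; ∃-syntax)
open import Data.Sum using (inj₁; inj₂)
open import Function using (_∘_)
open import Function.Bundles using (_⇔_; mk⇔; module Equivalence)
open Equivalence using (to; from)
open import Relation.Nullary using (¬_; yes; no)
open import Level using (0ℓ)
open import Relation.Binary.Bundles using (Setoid)
open import Relation.Binary.PropositionalEquality using (_≡_; refl; sym; trans; cong; cong₂; subst; module ≡-Reasoning)

map-↭-of-inverseOn : ∀ {A : Set} {xs : List A} {f g : A → A} → Unique xs →
  (∀ {x} → x ∈ xs → f x ∈ xs) → (∀ {x} → x ∈ xs → g x ∈ xs) →
  (∀ {x} → x ∈ xs → g (f x) ≡ x) → (∀ {x} → x ∈ xs → f (g x) ≡ x) →
  map f xs ↭ xs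
map-↭-of-inverseOn {xs = xs} {f} {g} xs! f∈ g∈ g∘f f∘g =
  ∼bag⇒↭ (unique∧set⇒bag fxs! xs! (mk⇔ image⊆xs xs⊆image))
  where
  image⊆xs : ∀ {y} → y ∈ map f xs → y ∈ xs
  image⊆xs y∈ with _ , x∈ , refl ← ∈-map⁻ f y∈ = f∈ x∈
  xs⊆image : ∀ {y} → y ∈ xs → y ∈ map f xs
  xs⊆image y∈ = subst (_∈ map f xs) (f∘g y∈) (∈-map⁺ f (g∈ y∈))
  fxs! : Unique (map f xs)
  fxs! = Unique.map⁻ {f = g} (subst Unique (sym (trans (sym (map-∘ xs)) (map-id-local (All.tabulate g∘f)))) xs!)

prime-divisor : ∀ {e} → ¬ e ≡ 1 → ∃[ p ] Prime p × p ∣ e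
prime-divisor {zero}       _   = 2 , prime[2] , 2 ∣0
prime-divisor {suc zero}   e≢1 = ⊥-elim (e≢1 refl)
prime-divisor {e@(2+ _)} _ with factorise e
... | record { factors = [] ; isFactorisation = () }
... | record { factors = p ∷ ps ; isFactorisation = e≡p*ps ; factorsPrime = p-prime ∷ _ } =
  p , p-prime , divides (product ps) (trans e≡p*ps (*-comm p (product ps)))

¬common-prime⇒coprime : ∀ {m k} → (∀ {p} → Prime p → p ∣ m → p ∣ k → ⊥) → Coprime m k
¬common-prime⇒coprime no-common {e} (e∣m , e∣k) with e ≟ 1
... | yes e≡1 = e≡1
... | no  e≢1 with p , p-prime , p∣e ← prime-divisor e≢1 =
  ⊥-elim (no-common p-prime (∣-trans p∣e e∣m) (∣-trans p∣e e∣k))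

module Modulo (n : ℕ) .{{_ : NonZero n}} where

  infix 4 _≈_
  record _≈_ (x y : ℕ) : Set where
    constructor mod
    field residues : x % n ≡ y % n
  open _≈_ public

  ≈-setoid : Setoid 0ℓ 0ℓ
  ≈-setoid = record
    { _≈_ = _≈_
    ; isEquivalence = record
      { refl  = mod refl
      ; sym   = λ x≈y → mod (sym (residues x≈y))
      ; trans = λ x≈y y≈z → mod (trans (residues x≈y) (residues y≈z))
      }
    }
  open Setoid ≈-setoid public using () renaming (refl to ≈-refl; sym to ≈-sym; trans to ≈-trans; reflexive to ≈-reflexive)

  private
    variable
      b x x′ y y′ z : ℕ

  %-≈ : ∀ x → x % n ≈ x
  %-≈ x = mod (m%n%n≡m%n x n)

  *-cong : x ≈ x′ → y ≈ y′ → x * y ≈ x′ * y′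
  *-cong {x} {x′} {y} {y′} (mod x≈x′) (mod y≈y′) = mod (begin
    x * y % n               ≡⟨ %-distribˡ-* x y n ⟩
    (x % n) * (y % n) % n   ≡⟨ cong₂ (λ s t → s * t % n) x≈x′ y≈y′ ⟩
    (x′ % n) * (y′ % n) % n ≡⟨ %-distribˡ-* x′ y′ n ⟨
    x′ * y′ % n             ∎)
    where open ≡-Reasoning

  *-congˡ : ∀ x → y ≈ y′ → x * y ≈ x * y′
  *-congˡ x = *-cong {x} ≈-refl

  *-congʳ : ∀ y → x ≈ x′ → x * y ≈ x′ * y
  *-congʳ y x≈x′ = *-cong x≈x′ (≈-refl {y})

  ^-congˡ : ∀ k → x ≈ y → x ^ℕ k ≈ y ^ℕ k
  ^-congˡ zero    _   = ≈-refl
  ^-congˡ (suc k) x≈y = *-cong x≈y (^-congˡ k x≈y)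

  open import Relation.Binary.Reasoning.Setoid ≈-setoid

  ^-≈1-∣ : ∀ {i j} → i ∣ j → b ^ℕ i ≈ 1 → b ^ℕ j ≈ 1
  ^-≈1-∣ {b} {i} (divides k refl) bⁱ≈1 = begin
    b ^ℕ (k * i)       ≡⟨ cong (b ^ℕ_) (*-comm k i) ⟩
    b ^ℕ (i * k)       ≡⟨ ^-*-assoc b i k ⟨
    (b ^ℕ i) ^ℕ k      ≈⟨ ^-congˡ k bⁱ≈1 ⟩
    1 ^ℕ k             ≡⟨ ^-zeroˡ k ⟩
    1                  ∎

  ^-≈1-cancelʳ : ∀ i {j} → b ^ℕ (i + j) ≈ 1 → b ^ℕ j ≈ 1 → b ^ℕ i ≈ 1
  ^-≈1-cancelʳ {b} i {j} bⁱ⁺ʲ≈1 bʲ≈1 = begin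
    b ^ℕ i              ≡⟨ *-identityʳ (b ^ℕ i) ⟨
    b ^ℕ i * 1          ≈⟨ *-congˡ (b ^ℕ i) bʲ≈1 ⟨
    b ^ℕ i * b ^ℕ j     ≡⟨ ^-distribˡ-+-* b i j ⟨
    b ^ℕ (i + j)        ≈⟨ bⁱ⁺ʲ≈1 ⟩
    1                   ∎

  ^-≈1-gcd : ∀ i j → b ^ℕ i ≈ 1 → b ^ℕ j ≈ 1 → b ^ℕ gcd i j ≈ 1
  ^-≈1-gcd {b} i j bⁱ≈1 bʲ≈1 with Bézout.identity (gcd-GCD i j)
  ... | Bézout.+- x y d+yj≡xi = ^-≈1-cancelʳ (gcd i j)
    (subst (λ e → b ^ℕ e ≈ 1) (sym d+yj≡xi) (^-≈1-∣ (n∣m*n x) bⁱ≈1)) (^-≈1-∣ (n∣m*n y) bʲ≈1)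
  ... | Bézout.-+ x y d+xi≡yj = ^-≈1-cancelʳ (gcd i j)
    (subst (λ e → b ^ℕ e ≈ 1) (sym d+xi≡yj) (^-≈1-∣ (n∣m*n y) bʲ≈1)) (^-≈1-∣ (n∣m*n x) bⁱ≈1)

  record Unit (x : ℕ) : Set where
    constructor unit
    field
      inverse  : ℕ
      inverseʳ : x * inverse ≈ 1

  unit-* : Unit x → Unit y → Unit (x * y)
  unit-* {x} {y} (unit x⁻¹ xx⁻¹≈1) (unit y⁻¹ yy⁻¹≈1) = unit (x⁻¹ * y⁻¹) (begin
    x * y * (x⁻¹ * y⁻¹)   ≡⟨ [m*n]*[o*p]≡[m*o]*[n*p] x y x⁻¹ y⁻¹ ⟩
    x * x⁻¹ * (y * y⁻¹)   ≈⟨ *-cong xx⁻¹≈1 yy⁻¹≈1 ⟩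
    1                     ∎)

  unit-product : ∀ {xs} → All Unit xs → Unit (product xs)
  unit-product []       = unit 1 ≈-refl
  unit-product (u ∷ us) = unit-* u (unit-product us)

  unit-resp-≈ : x ≈ y → Unit x → Unit y
  unit-resp-≈ x≈y (unit x⁻¹ xx⁻¹≈1) = unit x⁻¹ (≈-trans (*-congʳ x⁻¹ (≈-sym x≈y)) xx⁻¹≈1)

  inverse-cancelˡ : ∀ x x′ y → x * x′ ≈ 1 → x′ * (x * y) ≈ y
  inverse-cancelˡ x x′ y xx′≈1 = begin
    x′ * (x * y)   ≡⟨ trans (cong (_* y) (*-comm x x′)) (*-assoc x′ x y) ⟨
    x * x′ * y     ≈⟨ *-congʳ y xx′≈1 ⟩
    1 * y          ≡⟨ *-identityˡ y ⟩
    y              ∎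

  unit-cancelˡ : Unit x → x * y ≈ x * z → y ≈ z
  unit-cancelˡ {x} {y} {z} (unit x⁻¹ xx⁻¹≈1) xy≈xz = begin
    y              ≈⟨ inverse-cancelˡ x x⁻¹ y xx⁻¹≈1 ⟨
    x⁻¹ * (x * y)  ≈⟨ *-congˡ x⁻¹ xy≈xz ⟩
    x⁻¹ * (x * z)  ≈⟨ inverse-cancelˡ x x⁻¹ z xx⁻¹≈1 ⟩
    z              ∎

  pow-unit : ∀ {k} .{{_ : NonZero k}} → b ^ℕ k ≈ 1 → Unit b
  pow-unit {b} {suc k} bᵏ⁺¹≈1 = unit (b ^ℕ k) bᵏ⁺¹≈1

  ∣-resp-≈ : ∀ {d} → d ∣ n → x ≈ y → d ∣ x → d ∣ y
  ∣-resp-≈ d∣n (mod x≈y) d∣x = ∣n∣m%n⇒∣m d∣n (subst (_ ∣_) x≈y (%-presˡ-∣ d∣x d∣n))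

  unit⇒coprime : Unit x → Coprime x n
  unit⇒coprime (unit y xy≈1) (d∣x , d∣n) = ∣1⇒≡1 (∣-resp-≈ d∣n xy≈1 (∣m⇒∣m*n y d∣x))

  coprime⇒unit : Coprime x n → Unit x
  coprime⇒unit {x} x⊥n with coprime-Bézout x⊥n
  ... | Bézout.+- a b 1+bn≡ax = unit a (begin
    x * a        ≡⟨ trans (*-comm x a) (sym 1+bn≡ax) ⟩
    1 + b * n    ≈⟨ mod ([m+kn]%n≡m%n 1 b n) ⟩
    1            ∎)
  -- here a x ≡ -1, so (n - 1) a inverts x
  ... | Bézout.-+ a b 1+ax≡bn = unit (pred n * a) (begin
    x * (pred n * a)                 ≈⟨ mod ([m+kn]%n≡m%n _ b n) ⟨
    x * (pred n * a) + b * n         ≡⟨ cong (λ t → x * (pred n * a) + t) 1+ax≡bn ⟨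
    x * (pred n * a) + (1 + a * x)   ≡⟨ x[pa]+[1+ax]≡1+ax[1+p] x a (pred n) ⟩
    1 + a * x * suc (pred n)         ≡⟨ cong (λ t → 1 + a * x * t) (suc-pred n) ⟩
    1 + a * x * n                    ≈⟨ mod ([m+kn]%n≡m%n 1 (a * x) n) ⟩
    1                                ∎)
    where
    x[pa]+[1+ax]≡1+ax[1+p] : ∀ x a p → x * (p * a) + (1 + a * x) ≡ 1 + a * x * suc p
    x[pa]+[1+ax]≡1+ax[1+p] = ℕ-Solver.solve-∀

  product-map-scale : ∀ u xs → product (map (λ x → u * x % n) xs) ≈ u ^ℕ length xs * product xs
  product-map-scale u []       = ≈-refl
  product-map-scale u (x ∷ xs) = begin
    (u * x % n) * product (map (λ x → u * x % n) xs)  ≈⟨ *-cong (%-≈ (u * x)) (product-map-scale u xs) ⟩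
    u * x * (u ^ℕ length xs * product xs)            ≡⟨ [m*n]*[o*p]≡[m*o]*[n*p] u x _ _ ⟩
    u * u ^ℕ length xs * (x * product xs)            ∎

reducedResidues : ℕ → List ℕ
reducedResidues n = filter (λ k → gcd k n ≟ 1) (map suc (upTo n))

reducedResidues-unique : ∀ n → Unique (reducedResidues n)
reducedResidues-unique n = Unique.filter⁺ (λ k → gcd k n ≟ 1) (Unique.map⁺ suc-injective (Unique.upTo⁺ n))

module _ {n : ℕ} .{{_ : NonTrivial n}} where

  private instance
    n≢0 : NonZero n
    n≢0 = nonTrivial⇒nonZero n

  open Modulo n

  private
    variable
      b u x : ℕ

  n≢1 : ¬ n ≡ 1
  n≢1 n≡1 = <-irrefl (sym n≡1) (nonTrivial⇒n>1 n)

  ¬coprime-self : ¬ Coprime n n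
  ¬coprime-self n⊥n = n≢1 (n⊥n (∣-refl , ∣-refl))

  ∈-reducedResidues⁻ : x ∈ reducedResidues n → Coprime x n × x < n
  ∈-reducedResidues⁻ x∈
    with x∈′ , gcd≡1 ← ∈-filter⁻ (λ k → gcd k n ≟ 1) {xs = map suc (upTo n)} x∈
    with k , k∈ , refl ← ∈-map⁻ suc x∈′
    with m≤n⇒m<n∨m≡n (∈-upTo⁻ k∈)
  ... | inj₁ 1+k<n = gcd≡1⇒coprime gcd≡1 , 1+k<n
  ... | inj₂ 1+k≡n = ⊥-elim (¬coprime-self (subst (λ t → Coprime t n) 1+k≡n (gcd≡1⇒coprime gcd≡1)))

  ∈-reducedResidues⁺ : Coprime x n → x < n → x ∈ reducedResidues n
  ∈-reducedResidues⁺ {zero}  0⊥n _   = ⊥-elim (¬0-coprimeTo-2+ 0⊥n)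
  ∈-reducedResidues⁺ {suc k} x⊥n x<n =
    ∈-filter⁺ (λ k → gcd k n ≟ 1) (∈-map⁺ suc (∈-upTo⁺ (<-trans (n<1+n k) x<n))) (coprime⇒gcd≡1 x⊥n)

  reducedResidue⇒unit : x ∈ reducedResidues n → Unit x
  reducedResidue⇒unit = coprime⇒unit ∘ proj₁ ∘ ∈-reducedResidues⁻

  scale-∈ : Unit u → x ∈ reducedResidues n → u * x % n ∈ reducedResidues n
  scale-∈ {u} {x} u-unit x∈ = ∈-reducedResidues⁺
    (unit⇒coprime (unit-resp-≈ (≈-sym (%-≈ (u * x))) (unit-* u-unit (reducedResidue⇒unit x∈))))
    (m%n<n (u * x) n)

  scale-inverse : ∀ u v → u * v ≈ 1 → x ∈ reducedResidues n → v * (u * x % n) % n ≡ x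
  scale-inverse {x} u v uv≈1 x∈ = begin
    v * (u * x % n) % n  ≡⟨ residues (*-congˡ v (%-≈ (u * x))) ⟩
    v * (u * x) % n      ≡⟨ residues (inverse-cancelˡ u v x uv≈1) ⟩
    x % n                ≡⟨ m<n⇒m%n≡m (proj₂ (∈-reducedResidues⁻ x∈)) ⟩
    x                    ∎
    where open ≡-Reasoning

  scale-↭ : Unit u → map (λ x → u * x % n) (reducedResidues n) ↭ reducedResidues n
  scale-↭ {u} u-unit@(unit v uv≈1) = map-↭-of-inverseOn (reducedResidues-unique n)
    (scale-∈ u-unit) (scale-∈ v-unit) (scale-inverse u v uv≈1) (scale-inverse v u vu≈1)
    where
    vu≈1 : v * u ≈ 1
    vu≈1 = ≈-trans (≈-reflexive (*-comm v u)) uv≈1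
    v-unit : Unit v
    v-unit = unit u vu≈1

  euler : Unit b → b ^ℕ φ n ≈ 1
  euler {b} b-unit = unit-cancelˡ P-unit (begin
    P * b ^ℕ φ n                                  ≡⟨ *-comm P _ ⟩
    b ^ℕ φ n * P                                  ≈⟨ product-map-scale b (reducedResidues n) ⟨
    product (map (λ x → b * x % n) (reducedResidues n)) ≡⟨ product-↭ (scale-↭ b-unit) ⟩
    P                                             ≡⟨ *-identityʳ P ⟨
    P * 1                                         ∎)
    where
    open import Relation.Binary.Reasoning.Setoid ≈-setoid
    P : ℕ
    P = product (reducedResidues n)
    P-unit : Unit P
    P-unit = unit-product (All.tabulate reducedResidue⇒unit)

  divides-φ : ∀ {N m} .{{_ : NonZero N}} → m ∣ N →
    (∀ q .{{_ : NonZero q}} → Prime q → q ∣ m → ∃[ b ] b ^ℕ N ≈ 1 × ¬ b ^ℕ (N / q) ≈ 1) →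
    m ∣ φ n
  divides-φ {N} {m} m∣N witness = ∣-trans m∣d (gcd[m,n]∣m (φ n) N)
    where
    d k : ℕ
    d = gcd (φ n) N
    k = quotient (gcd[m,n]∣n (φ n) N)

    N≡k*d : N ≡ k * d
    N≡k*d = m∣n⇒n≡quotient*m (gcd[m,n]∣n (φ n) N)

    ^d≈1 : b ^ℕ N ≈ 1 → b ^ℕ d ≈ 1
    ^d≈1 bᴺ≈1 = ^-≈1-gcd (φ n) N (euler (pow-unit bᴺ≈1)) bᴺ≈1

    no-common-prime : ∀ {p} → Prime p → p ∣ m → p ∣ k → ⊥
    no-common-prime {p} p-prime p∣m p∣k
      with b , bᴺ≈1 , bᴺ/ᵖ≉1 ← witness p {{prime⇒nonZero p-prime}} p-prime p∣m =
      bᴺ/ᵖ≉1 (^-≈1-∣ d∣N/p (^d≈1 bᴺ≈1))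
      where
      instance _ = prime⇒nonZero p-prime
      d∣N/p : d ∣ N / p
      d∣N/p = m*n∣o⇒n∣o/m p d (subst (p * d ∣_) (sym N≡k*d) (*-monoˡ-∣ d p∣k))

    m∣d : m ∣ d
    m∣d = coprime-divisor (¬common-prime⇒coprime no-common-prime) (subst (m ∣_) N≡k*d m∣N)

module _ {n : ℕ} where

  ≡[mod]⇒∣ : ∀ x y → x ≡ y [mod n ] → + n ℤ∣.∣ x ℤ.- y
  ≡[mod]⇒∣ x y = ℤ∣.∣ᵤ⇒∣

  ≡[mod]-sym : ∀ x y → x ≡ y [mod n ] → y ≡ x [mod n ]
  ≡[mod]-sym x y = subst (n ∣_) (ℤₚ.∣i-j∣≡∣j-i∣ x y)

  ≡[mod]-trans : ∀ x y z → x ≡ y [mod n ] → y ≡ z [mod n ] → x ≡ z [mod n ]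
  ≡[mod]-trans x y z x≡y y≡z = ℤ∣.∣⇒∣ᵤ (subst (+ n ℤ∣.∣_) (ℤₚ.+-minus-telescope x y z)
    (ℤ∣.∣m∣n⇒∣m+n (≡[mod]⇒∣ x y x≡y) (≡[mod]⇒∣ y z y≡z)))

  ≡[mod]-^ : ∀ x y k → x ≡ y [mod n ] → x ^ k ≡ y ^ k [mod n ]
  ≡[mod]-^ x y zero    _   = n ∣0
  ≡[mod]-^ x y (suc k) x≡y = ℤ∣.∣⇒∣ᵤ (subst (+ n ℤ∣.∣_) (sym (xx′-yy′≡x[x′-y′]+[x-y]y′ x (x ^ k) y (y ^ k)))
    (ℤ∣.∣m∣n⇒∣m+n (ℤ∣.∣n⇒∣m*n x (≡[mod]⇒∣ (x ^ k) (y ^ k) (≡[mod]-^ x y k x≡y)))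
                  (ℤ∣.∣m⇒∣m*n (y ^ k) (≡[mod]⇒∣ x y x≡y))))
    where
    xx′-yy′≡x[x′-y′]+[x-y]y′ : ∀ x x′ y y′ → x ℤ.* x′ ℤ.- y ℤ.* y′ ≡ x ℤ.* (x′ ℤ.- y′) ℤ.+ (x ℤ.- y) ℤ.* y′
    xx′-yy′≡x[x′-y′]+[x-y]y′ = ℤ-Solver.solve-∀

  ≡[mod]-%ℕ : .{{_ : NonZero n}} → ∀ x → x ≡ + (x %ℕ n) [mod n ]
  ≡[mod]-%ℕ x = ℤ∣.∣⇒∣ᵤ (ℤ∣.divides (x /ℕ n) (begin
    x ℤ.- + (x %ℕ n)                                 ≡⟨ cong (ℤ._- + (x %ℕ n)) (a≡a%ℕn+[a/ℕn]*n x n) ⟩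
    + (x %ℕ n) ℤ.+ (x /ℕ n) ℤ.* + n ℤ.- + (x %ℕ n)   ≡⟨ [r+s]-r≡s (+ (x %ℕ n)) ((x /ℕ n) ℤ.* + n) ⟩
    (x /ℕ n) ℤ.* + n                                 ∎))
    where
    open ≡-Reasoning
    [r+s]-r≡s : ∀ r s → r ℤ.+ s ℤ.- r ≡ s
    [r+s]-r≡s = ℤ-Solver.solve-∀

pos-^ : ∀ x k → (+ x) ^ k ≡ + (x ^ℕ k)
pos-^ x zero    = refl
pos-^ x (suc k) = trans (cong (+ x ℤ.*_) (pos-^ x k)) (sym (ℤₚ.pos-* x (x ^ℕ k)))

module _ {n : ℕ} .{{_ : NonTrivial n}} where

  private instance
    n≢0 : NonZero n
    n≢0 = nonTrivial⇒nonZero n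

  open Modulo n

  -- By computation, + 0 ≡ 1ℤ [mod n ] is n ∣ 1 and + (suc x) ≡ 1ℤ [mod n ] is n ∣ x.
  pos≡1[mod]⇔≈1 : ∀ x → + x ≡ 1ℤ [mod n ] ⇔ x ≈ 1
  pos≡1[mod]⇔≈1 zero    = mk⇔ (⊥-elim ∘ n≢1 ∘ ∣1⇒≡1)
    (λ 0≈1 → ⊥-elim (n≢1 (∣1⇒≡1 (∣-resp-≈ ∣-refl 0≈1 (n ∣0)))))
  pos≡1[mod]⇔≈1 (suc x) = mk⇔ (mod ∘ %-remove-+ʳ 1) n∣x
    where
    n∣x : suc x ≈ 1 → n ∣ x
    n∣x (mod 1+x≈1) = divides (suc x / n) (suc-injective (begin
      suc x                      ≡⟨ m≡m%n+[m/n]*n (suc x) n ⟩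
      suc x % n + suc x / n * n  ≡⟨ cong (_+ suc x / n * n) (trans 1+x≈1 (m<n⇒m%n≡m (nonTrivial⇒n>1 n))) ⟩
      1 + suc x / n * n          ∎))
      where open ≡-Reasoning

  ^≡1[mod]⇔ : ∀ b k → b ^ k ≡ 1ℤ [mod n ] ⇔ (b %ℕ n) ^ℕ k ≈ 1
  ^≡1[mod]⇔ b k = mk⇔
    (to (pos≡1[mod]⇔≈1 rᵏ) ∘ ≡[mod]-trans (+ rᵏ) (b ^ k) 1ℤ (≡[mod]-sym (b ^ k) (+ rᵏ) bᵏ≡rᵏ))
    (≡[mod]-trans (b ^ k) (+ rᵏ) 1ℤ bᵏ≡rᵏ ∘ from (pos≡1[mod]⇔≈1 rᵏ))
    where
    rᵏ : ℕ
    rᵏ = (b %ℕ n) ^ℕ k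
    bᵏ≡rᵏ : b ^ k ≡ + rᵏ [mod n ]
    bᵏ≡rᵏ = subst (λ t → b ^ k ≡ t [mod n ]) (pos-^ (b %ℕ n) k) (≡[mod]-^ b (+ (b %ℕ n)) k (≡[mod]-%ℕ b))

  residue-witness : ∀ i j → Σ ℤ (λ b → b ^ i ≡ 1ℤ [mod n ] × ¬ b ^ j ≡ 1ℤ [mod n ]) →
    ∃[ r ] r ^ℕ i ≈ 1 × ¬ r ^ℕ j ≈ 1
  residue-witness i j (b , bⁱ≡1 , bʲ≢1) = b %ℕ n , to (^≡1[mod]⇔ b i) bⁱ≡1 , bʲ≢1 ∘ from (^≡1[mod]⇔ b j)

theorem4p1 : (a m : ℕ) → a > 0 → m > 1 → Coprime a m →
  (m ∣ φ (a * m + 1) → Prime (a * m + 1)) →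
  ((q : ℕ) → .{{_ : NonZero q}} → Prime q → q ∣ m →
    Σ ℤ (λ b → (b ^ (a * m) ≡ 1ℤ [mod a * m + 1 ])
      × ¬ (b ^ ((a * m) / q) ≡ 1ℤ [mod a * m + 1 ]))) →
  Prime (a * m + 1)
theorem4p1 _       (suc zero)       _ (s≤s ()) _ _         _
theorem4p1 (suc a) m@(suc (suc _)) _ _        _ m∣φ⇒prime witness =
  m∣φ⇒prime (divides-φ (n∣m*n (suc a)) λ q q-prime q∣m →
    residue-witness (suc a * m) (suc a * m / q) (witness q q-prime q∣m))
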